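{- Let $\mu \ge 0$, $g \ge 1$, $u \ge 3$ be integers. Suppose the complete multipartite graph $K_u \cdot \overline{K_g}$ (with $u$ parts of size $g$) has an edge-decomposition into subgraphs $G_1,G_2,\dots,G_k$, and set $s_0=\mu$ and $s_i=\mu+\sum_{j\le i}|E(G_j)|$ for $1\le i\le k$. Suppose that for each $i$ there exists a multiset of triangles, each with all edges in $G_i$, such that the numbers of triangles in this multiset containing the respective edges of $G_i$ are pairwise distinct and form exactly the set $\{s_{i-1},s_{i-1}+1,\dots,s_i-1\}$. Then there exists an SBGDD$_\mu$ of type $g^u$.
   Context: For a multiset $\mathcal{B}$ of subsets of a set $V$ and $X \subseteq V$, the frequency of $X$ is the number of members of $\mathcal{B}$ (counted with multiplicity) containing $X$. An SBGDD$_\mu$ of type $g^u$ is a triple $(V,\Pi,\mathcal{B})$ where $V$ is a set of $gu$ points, $\Pi$ is a partition of $V$ into $u$ groups each of size $g$, and $\mathcal{B}$ is a multiset of 3-element subsets of $V$, such that every pair of points in the same group has frequency $0$, and the frequencies of pairs of points in different groups are pairwise distinct and form exactly the set $\{\mu,\dots,\mu+g^2\binom{u}{2}-1\}$. (Equivalently, a multiset of triangles in $K_u\cdot\overline{K_g}$ covering its edges with these frequencies.) -}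

module Defs where

open import Data.Nat using (ℕ; zero; suc; _+_; _*_; _≤_; _<_)
open import Data.Nat.Combinatorics using (_C_)
open import Data.Bool using (Bool; true; false; _∧_; _∨_)
open import Data.Fin using (Fin; zero; suc)
open import Data.Fin.Properties using () renaming (_≟_ to _≟ᶠ_)
open import Data.Product using (Σ; ∃; _×_; _,_; proj₁; proj₂)
open import Data.Product.Properties using (≡-dec)
open import Data.Sum using (_⊎_)
open import Data.List using (List; []; _∷_; map; allFin)
open import Data.Nat.ListAction using (sum)
open import Data.List.Relation.Unary.All using (All)
open import Data.List.Membership.Propositional using (_∈_)
open import Relation.Nullary using (¬_)
open import Relation.Nullary.Decidable using (⌊_⌋)
open import Relation.Binary.PropositionalEquality using (_≡_; _≢_)

-- Points of K_u · \bar{K_g}: a point is (group index, position in group).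
-- The u groups are the fibres of proj₁, each of size g.
Point : ℕ → ℕ → Set
Point u g = Fin u × Fin g

_≟ₚ_ : ∀ {u g} (x y : Point u g) → Relation.Nullary.Dec (x ≡ y)
_≟ₚ_ = ≡-dec _≟ᶠ_ _≟ᶠ_

eqᵇ : ∀ {u g} → Point u g → Point u g → Bool
eqᵇ x y = ⌊ x ≟ₚ y ⌋

SameGroup : ∀ {u g} → Point u g → Point u g → Set
SameGroup x y = proj₁ x ≡ proj₁ y

Cross : ∀ {u g} → Point u g → Point u g → Set
Cross x y = ¬ SameGroup x y

-- An edge / unordered pair is represented by an ordered pair of points.
Edge : ℕ → ℕ → Set
Edge u g = Point u g × Point u g

PairIs : ∀ {u g} → Point u g → Point u g → Edge u g → Set
PairIs x y e = (x ≡ proj₁ e × y ≡ proj₂ e) ⊎ (x ≡ proj₂ e × y ≡ proj₁ e)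

pairIsᵇ : ∀ {u g} → Point u g → Point u g → Edge u g → Bool
pairIsᵇ x y e = (eqᵇ x (proj₁ e) ∧ eqᵇ y (proj₂ e)) ∨ (eqᵇ x (proj₂ e) ∧ eqᵇ y (proj₁ e))

countᵇ : ∀ {A : Set} → (A → Bool) → List A → ℕ
countᵇ p [] = 0
countᵇ p (a ∷ as) with p a
... | true  = suc (countᵇ p as)
... | false = countᵇ p as

-- A 3-element subset {a,b,c} of the point set, represented by a triple of
-- pairwise distinct points.  A multiset of 3-subsets is a list of these.
Triple : ℕ → ℕ → Set
Triple u g = Point u g × Point u g × Point u g

IsTriangle : ∀ {u g} → Triple u g → Set
IsTriangle (a , b , c) = a ≢ b × a ≢ c × b ≢ c

inTripleᵇ : ∀ {u g} → Point u g → Triple u g → Bool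
inTripleᵇ x (a , b , c) = eqᵇ x a ∨ eqᵇ x b ∨ eqᵇ x c

freq : ∀ {u g} → List (Triple u g) → Point u g → Point u g → ℕ
freq B x y = countᵇ (λ t → inTripleᵇ x t ∧ inTripleᵇ y t) B

IsSBGDD : (μ g u : ℕ) → List (Triple u g) → Set
IsSBGDD μ g u B =
  All IsTriangle B ×
  (∀ (x y : Point u g) → x ≢ y → SameGroup x y → freq B x y ≡ 0) ×
  (∀ (x y : Point u g) → Cross x y →
      μ ≤ freq B x y × freq B x y < μ + g * g * (u C 2)) ×
  (∀ (x y x' y' : Point u g) → Cross x y → Cross x' y' →
      freq B x y ≡ freq B x' y' → PairIs x y (x' , y')) ×
  (∀ (t : ℕ) → μ ≤ t → t < μ + g * g * (u C 2) →
      ∃ λ (x : Point u g) → ∃ λ (y : Point u g) → Cross x y × freq B x y ≡ t)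

SBGDD : (μ g u : ℕ) → Set
SBGDD μ g u = Σ (List (Triple u g)) (IsSBGDD μ g u)

IsEdgeDecomposition : ∀ {u g k} → (Fin k → List (Edge u g)) → Set
IsEdgeDecomposition {u} {g} {k} G =
  (∀ i → All (λ e → Cross (proj₁ e) (proj₂ e)) (G i)) ×
  (∀ (x y : Point u g) → Cross x y →
      sum (map (λ i → countᵇ (pairIsᵇ x y) (G i)) (allFin k)) ≡ 1)

before : ∀ {k} → (Fin k → ℕ) → Fin k → ℕ
before f zero    = 0
before f (suc i) = f zero + before (λ j → f (suc j)) i

TriangleIn : ∀ {u g} → List (Edge u g) → Triple u g → Set
TriangleIn E (a , b , c) =
  (∃ λ e → e ∈ E × PairIs a b e) ×
  (∃ λ e → e ∈ E × PairIs a c e) ×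
  (∃ λ e → e ∈ E × PairIs b c e)

HasStarterTriangles : ∀ {u g} → List (Edge u g) → ℕ → ℕ → Set
HasStarterTriangles {u} {g} E lo hi =
  Σ (List (Triple u g)) λ T →
    All IsTriangle T × All (TriangleIn E) T ×
    (∀ e e' → e ∈ E → e' ∈ E →
       freq T (proj₁ e) (proj₂ e) ≡ freq T (proj₁ e') (proj₂ e') →
       PairIs (proj₁ e) (proj₂ e) e') ×
    (∀ e → e ∈ E → lo ≤ freq T (proj₁ e) (proj₂ e) × freq T (proj₁ e) (proj₂ e) < hi) ×
    (∀ t → lo ≤ t → t < hi → ∃ λ e → e ∈ E × freq T (proj₁ e) (proj₂ e) ≡ t)

-- The starter multisets of the parts G_i are simply concatenated. A triangle of the i-th
-- multiset has all its edges in G_i, so it raises only the frequencies of edges of G_i;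
-- since every cross pair is an edge of exactly one part, its frequency in the union is its
-- frequency in that part. Hence the parts occupy the disjoint consecutive blocks
-- [s_{i-1}, s_i) of frequencies, which tile [μ, μ + Σ |E(G_i)|), and double counting gives
-- Σ |E(G_i)| = g² C(u,2), the number of edges of K_u · \bar{K_g}.

{-# OPTIONS --safe #-}
module Submission where

open import Defs
open import Data.Nat using (ℕ; zero; suc; _+_; _*_; _∸_; _≤_; _<_; z≤n; s≤s; _<?_)
open import Data.Nat.Properties
open import Data.Nat.Combinatorics using (_C_; nC1≡n; nCk+nC[k+1]≡[n+1]C[k+1])
open import Data.Nat.ListAction using (sum)
open import Data.Nat.Solver using (module +-*-Solver)
open import Data.Bool using (Bool; true; false; T; _∧_; _∨_)
open import Data.Bool.Properties using (T-∧; T-∨; ∧-comm)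
open import Data.Fin using (Fin; zero; suc; punchIn; punchOut) renaming (_≟_ to _≟ᶠ_)
open import Data.Fin.Properties using (punchInᵢ≢i; punchIn-punchOut)
open import Data.Product as Product using (∃; _×_; _,_; proj₁; proj₂)
open import Data.Sum as Sum using (_⊎_; inj₁; inj₂)
open import Data.List using (List; []; _∷_; _++_; map; length; concat; tabulate; allFin)
open import Data.List.Properties using (length-++; map-tabulate)
open import Data.List.Relation.Unary.All as All using (All; []; _∷_)
open import Data.List.Relation.Unary.All.Properties using (concat⁺; tabulate⁺)
open import Data.List.Relation.Unary.Any using (here; there)
open import Data.List.Membership.Propositional using (_∈_)
open import Function using (_∘_; _⇔_; mk⇔; Equivalence)
open import Relation.Nullary using (¬_; yes; no; contradiction)
open import Relation.Nullary.Decidable using (toWitness; fromWitness)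
open import Relation.Binary.PropositionalEquality
open import Algebra.Properties.CommutativeMonoid.Sum +-0-commutativeMonoid
  using (sum-syntax; sum-cong-≗; ∑-distrib-+; sum-remove)
  renaming (sum to ∑)

open Equivalence using (to; from)
open +-*-Solver using (solve; _:+_; _:*_; _:=_; con)

private
  variable
    u g k : ℕ
    A : Set

∑-const : ∀ n c → ∑[ i < n ] c ≡ n * c
∑-const zero    c = refl
∑-const (suc n) c = cong (c +_) (∑-const n c)

∑-zero : ∀ {n} {h : Fin n → ℕ} → (∀ i → h i ≡ 0) → ∑ h ≡ 0
∑-zero {n} h≡0 = trans (sum-cong-≗ h≡0) (trans (∑-const n 0) (*-zeroʳ n))

≤-∑ : ∀ {n} (h : Fin n → ℕ) i → h i ≤ ∑ h
≤-∑ {suc n} h i = subst (h i ≤_) (sym (sum-remove {i = i} h)) (m≤m+n (h i) _)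

∑-const-off : ∀ {n c} (h : Fin (suc n) → ℕ) i → (∀ j → j ≢ i → h j ≡ c) → ∑ h ≡ h i + n * c
∑-const-off {n} {c} h i h≡c = begin
  ∑ h                                ≡⟨ sum-remove {i = i} h ⟩
  h i + ∑ (λ j → h (punchIn i j))    ≡⟨ cong (h i +_) (sum-cong-≗ (λ j → h≡c _ (punchInᵢ≢i i j))) ⟩
  h i + ∑[ j < n ] c                 ≡⟨ cong (h i +_) (∑-const n c) ⟩
  h i + n * c                        ∎
  where open ≡-Reasoning

∑-single : ∀ {n} (h : Fin n → ℕ) i → (∀ j → j ≢ i → h j ≡ 0) → ∑ h ≡ h i
∑-single {suc n} h i h≡0 =
  trans (∑-const-off h i h≡0) (trans (cong (h i +_) (*-zeroʳ n)) (+-identityʳ (h i)))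

∑-positive : ∀ {n} (h : Fin n → ℕ) → 0 < ∑ h → ∃ λ i → 0 < h i
∑-positive {suc n} h ∑>0 with h zero in h₀
... | suc _ = zero , subst (0 <_) (sym h₀) (s≤s z≤n)
... | zero  = let i , hᵢ>0 = ∑-positive (h ∘ suc) ∑>0 in suc i , hᵢ>0

∑≡1-positive-unique : ∀ {n} (h : Fin n → ℕ) → ∑ h ≡ 1 → ∀ {i j} → 0 < h i → 0 < h j → i ≡ j
∑≡1-positive-unique {suc n} h ∑≡1 {i} {j} hᵢ>0 hⱼ>0 with i ≟ᶠ j
... | yes i≡j = i≡j
... | no  i≢j = contradiction 2≤1 λ { (s≤s ()) }
  where
  rest : Fin n → ℕ
  rest l = h (punchIn i l)
  hⱼ≤rest : h j ≤ ∑ rest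
  hⱼ≤rest = subst (_≤ ∑ rest) (cong h (punchIn-punchOut i≢j)) (≤-∑ rest (punchOut i≢j))
  2≤1 : 2 ≤ 1
  2≤1 = ≤-trans (+-mono-≤ hᵢ>0 hⱼ>0)
          (≤-trans (+-monoʳ-≤ (h i) hⱼ≤rest) (≤-reflexive (trans (sym (sum-remove {i = i} h)) ∑≡1)))

sum-tabulate : ∀ {n} (f : Fin n → ℕ) → sum (tabulate f) ≡ ∑ f
sum-tabulate {zero}  f = refl
sum-tabulate {suc n} f = cong (f zero +_) (sum-tabulate (f ∘ suc))

sum-map-allFin : ∀ {n} (f : Fin n → ℕ) → sum (map f (allFin n)) ≡ ∑ f
sum-map-allFin f = trans (cong sum (map-tabulate (λ i → i) f)) (sum-tabulate f)

2*nC2≡n*[n∸1] : ∀ n → 2 * (n C 2) ≡ n * (n ∸ 1)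
2*nC2≡n*[n∸1] zero          = refl
2*nC2≡n*[n∸1] (suc zero)    = refl
2*nC2≡n*[n∸1] (suc (suc m)) = begin
  2 * (suc (suc m) C 2)             ≡⟨ cong (2 *_) (nCk+nC[k+1]≡[n+1]C[k+1] (suc m) 1) ⟨
  2 * (suc m C 1 + suc m C 2)       ≡⟨ cong (λ c → 2 * (c + suc m C 2)) (nC1≡n (suc m)) ⟩
  2 * (suc m + suc m C 2)           ≡⟨ *-distribˡ-+ 2 (suc m) _ ⟩
  2 * suc m + 2 * (suc m C 2)       ≡⟨ cong (2 * suc m +_) (2*nC2≡n*[n∸1] (suc m)) ⟩
  2 * suc m + suc m * m             ≡⟨ solve 1 (λ m → con 2 :* (con 1 :+ m) :+ (con 1 :+ m) :* m
                                                   := (con 2 :+ m) :* (con 1 :+ m)) refl m ⟩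
  suc (suc m) * suc m               ∎
  where open ≡-Reasoning

-- Consecutive blocks of integers

record InBlock (c : ℕ) (f : Fin k → ℕ) (i : Fin k) (t : ℕ) : Set where
  constructor inBlock
  field
    lower : c + before f i ≤ t
    upper : t < c + before f i + f i

module _ {c t : ℕ} {f : Fin (suc k) → ℕ} where

  inBlock-suc⁻ : ∀ {i} → InBlock c f (suc i) t → InBlock (c + f zero) (f ∘ suc) i t
  inBlock-suc⁻ {i} (inBlock lo hi) = inBlock
    (subst (_≤ t) (sym (+-assoc c _ _)) lo)
    (subst (λ s → t < s + f (suc i)) (sym (+-assoc c _ _)) hi)

  inBlock-suc⁺ : ∀ {i} → InBlock (c + f zero) (f ∘ suc) i t → InBlock c f (suc i) t
  inBlock-suc⁺ {i} (inBlock lo hi) = inBlock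
    (subst (_≤ t) (+-assoc c _ _) lo)
    (subst (λ s → t < s + f (suc i)) (+-assoc c _ _) hi)

  inBlock-zero-suc : ∀ {i} → InBlock c f zero t → ¬ InBlock c f (suc i) t
  inBlock-zero-suc {i} (inBlock _ t<) (inBlock lo _) = n≮n t (begin-strict
    t                                   <⟨ t< ⟩
    c + 0 + f zero                      ≡⟨ cong (_+ f zero) (+-identityʳ c) ⟩
    c + f zero                          ≤⟨ +-monoʳ-≤ c (m≤m+n (f zero) _) ⟩
    c + (f zero + before (f ∘ suc) i)   ≤⟨ lo ⟩
    t                                   ∎)
    where open ≤-Reasoning

inBlock-unique : ∀ {c t} {f : Fin k → ℕ} {i j} → InBlock c f i t → InBlock c f j t → i ≡ j
inBlock-unique {i = zero}  {zero}  _ _ = refl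
inBlock-unique {i = zero}  {suc j} p q = contradiction q (inBlock-zero-suc p)
inBlock-unique {i = suc i} {zero}  p q = contradiction p (inBlock-zero-suc q)
inBlock-unique {i = suc i} {suc j} p q = cong suc (inBlock-unique (inBlock-suc⁻ p) (inBlock-suc⁻ q))

before+≤∑ : (f : Fin k → ℕ) (i : Fin k) → before f i + f i ≤ ∑ f
before+≤∑ f zero    = m≤m+n (f zero) _
before+≤∑ f (suc i) =
  subst (_≤ ∑ f) (sym (+-assoc (f zero) _ _)) (+-monoʳ-≤ (f zero) (before+≤∑ (f ∘ suc) i))

inBlock-bounds : ∀ {c t} {f : Fin k → ℕ} {i} → InBlock c f i t → c ≤ t × t < c + ∑ f
inBlock-bounds {c = c} {f = f} {i} (inBlock lo hi) =
  ≤-trans (m≤m+n c _) lo ,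
  <-≤-trans hi (subst (_≤ c + ∑ f) (sym (+-assoc c _ _)) (+-monoʳ-≤ c (before+≤∑ f i)))

inBlock-cover : ∀ {c t} (f : Fin k → ℕ) → c ≤ t → t < c + ∑ f → ∃ λ i → InBlock c f i t
inBlock-cover {zero}  {c} f c≤t t< =
  contradiction (≤-<-trans c≤t t<) (n≮n c ∘ subst (c <_) (+-identityʳ c))
inBlock-cover {suc k} {c} {t} f c≤t t< with t <? c + f zero
... | yes t<c+f₀ = zero , inBlock (subst (_≤ t) (sym (+-identityʳ c)) c≤t)
                                  (subst (t <_) (cong (_+ f zero) (sym (+-identityʳ c))) t<c+f₀)
... | no  t≮c+f₀ =
  let i , inᵢ = inBlock-cover (f ∘ suc) (≮⇒≥ t≮c+f₀) (subst (t <_) (sym (+-assoc c _ _)) t<)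
  in suc i , inBlock-suc⁺ inᵢ

⟦_⟧ : Bool → ℕ
⟦ true  ⟧ = 1
⟦ false ⟧ = 0

⟦⟧≡1 : ∀ b → T b → ⟦ b ⟧ ≡ 1
⟦⟧≡1 true _ = refl

⟦⟧≡0 : ∀ b → ¬ T b → ⟦ b ⟧ ≡ 0
⟦⟧≡0 true  ¬t = contradiction _ ¬t
⟦⟧≡0 false _  = refl

⟦∨⟧-disjoint : ∀ p q → ¬ (T p × T q) → ⟦ p ∨ q ⟧ ≡ ⟦ p ⟧ + ⟦ q ⟧
⟦∨⟧-disjoint true  true  ¬both = contradiction _ ¬both
⟦∨⟧-disjoint true  false _     = refl
⟦∨⟧-disjoint false q     _     = refl

countᵇ-∷ : (p : A → Bool) (a : A) (as : List A) → countᵇ p (a ∷ as) ≡ ⟦ p a ⟧ + countᵇ p as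
countᵇ-∷ p a as with p a
... | true  = refl
... | false = refl

countᵇ-++ : (p : A → Bool) (xs ys : List A) → countᵇ p (xs ++ ys) ≡ countᵇ p xs + countᵇ p ys
countᵇ-++ p []       ys = refl
countᵇ-++ p (x ∷ xs) ys rewrite countᵇ-∷ p x (xs ++ ys) | countᵇ-∷ p x xs | countᵇ-++ p xs ys =
  sym (+-assoc ⟦ p x ⟧ _ _)

countᵇ-concat : ∀ {n} (p : A → Bool) (F : Fin n → List A) →
  countᵇ p (concat (tabulate F)) ≡ ∑[ i < n ] countᵇ p (F i)
countᵇ-concat {n = zero}  p F = refl
countᵇ-concat {n = suc n} p F =
  trans (countᵇ-++ p (F zero) _) (cong (countᵇ p (F zero) +_) (countᵇ-concat p (F ∘ suc)))

countᵇ-cong : {p q : A → Bool} → (∀ a → p a ≡ q a) → ∀ xs → countᵇ p xs ≡ countᵇ q xs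
countᵇ-cong             p≡q []       = refl
countᵇ-cong {p = p} {q} p≡q (x ∷ xs) rewrite countᵇ-∷ p x xs | countᵇ-∷ q x xs | p≡q x =
  cong (⟦ q x ⟧ +_) (countᵇ-cong p≡q xs)

countᵇ>0⇒∈ : (p : A → Bool) (xs : List A) → 0 < countᵇ p xs → ∃ λ a → a ∈ xs × T (p a)
countᵇ>0⇒∈ p (x ∷ xs) c>0 with p x in px
... | true  = x , here refl , subst T (sym px) _
... | false = let a , a∈ , pa = countᵇ>0⇒∈ p xs c>0 in a , there a∈ , pa

∈⇒countᵇ>0 : (p : A → Bool) {a : A} (xs : List A) → a ∈ xs → T (p a) → 0 < countᵇ p xs
∈⇒countᵇ>0 p (x ∷ xs) (here refl) pa rewrite countᵇ-∷ p x xs | ⟦⟧≡1 (p x) pa = s≤s z≤n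
∈⇒countᵇ>0 p (x ∷ xs) (there a∈)  pa rewrite countᵇ-∷ p x xs =
  ≤-trans (∈⇒countᵇ>0 p xs a∈ pa) (m≤n+m _ _)

countᵇ≡0 : (p : A → Bool) (xs : List A) → (∀ a → a ∈ xs → ¬ T (p a)) → countᵇ p xs ≡ 0
countᵇ≡0 p []       _    = refl
countᵇ≡0 p (x ∷ xs) none rewrite countᵇ-∷ p x xs | ⟦⟧≡0 (p x) (none x (here refl)) =
  countᵇ≡0 p xs (λ a a∈ → none a (there a∈))

length-concat-tabulate : ∀ {n} (F : Fin n → List A) →
  length (concat (tabulate F)) ≡ ∑[ i < n ] length (F i)
length-concat-tabulate {n = zero}  F = refl
length-concat-tabulate {n = suc n} F =
  trans (length-++ (F zero)) (cong (length (F zero) +_) (length-concat-tabulate (F ∘ suc)))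

module _ {x y : Point u g} where

  cross⇒≢ : Cross x y → x ≢ y
  cross⇒≢ c refl = c refl

  PairIs-swap : ∀ {e} → PairIs x y e → PairIs y x e
  PairIs-swap (inj₁ (x≡ , y≡)) = inj₂ (y≡ , x≡)
  PairIs-swap (inj₂ (x≡ , y≡)) = inj₁ (y≡ , x≡)

  PairIs-sym : ∀ {x′ y′} → PairIs x y (x′ , y′) → PairIs x′ y′ (x , y)
  PairIs-sym (inj₁ (refl , refl)) = inj₁ (refl , refl)
  PairIs-sym (inj₂ (refl , refl)) = inj₂ (refl , refl)

  PairIs-trans : ∀ {x′ y′ e} → PairIs x y (x′ , y′) → PairIs x′ y′ e → PairIs x y e
  PairIs-trans (inj₁ (refl , refl)) q                    = q
  PairIs-trans (inj₂ (refl , refl)) (inj₁ (refl , refl)) = inj₂ (refl , refl)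
  PairIs-trans (inj₂ (refl , refl)) (inj₂ (refl , refl)) = inj₁ (refl , refl)

  PairIs-cross : ∀ {e : Edge u g} → PairIs x y e → Cross (proj₁ e) (proj₂ e) → Cross x y
  PairIs-cross (inj₁ (refl , refl)) c = c
  PairIs-cross (inj₂ (refl , refl)) c = c ∘ sym

  freq-sym : ∀ B → freq B x y ≡ freq B y x
  freq-sym = countᵇ-cong (λ t → ∧-comm (inTripleᵇ x t) (inTripleᵇ y t))

  freq-PairIs : ∀ B e → PairIs x y e → freq B x y ≡ freq B (proj₁ e) (proj₂ e)
  freq-PairIs B e (inj₁ (refl , refl)) = refl
  freq-PairIs B e (inj₂ (refl , refl)) = freq-sym B

T-eqᵇ : (x y : Point u g) → T (eqᵇ x y) ⇔ x ≡ y
T-eqᵇ x y = mk⇔ toWitness fromWitness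

T-eqᵇ∧eqᵇ : (x a y b : Point u g) → T (eqᵇ x a ∧ eqᵇ y b) ⇔ (x ≡ a × y ≡ b)
T-eqᵇ∧eqᵇ x a y b = mk⇔
  (Product.map (to (T-eqᵇ x a)) (to (T-eqᵇ y b)) ∘ to (T-∧ {eqᵇ x a}))
  (from (T-∧ {eqᵇ x a}) ∘ Product.map (from (T-eqᵇ x a)) (from (T-eqᵇ y b)))

T-pairIsᵇ : (x y : Point u g) (e : Edge u g) → T (pairIsᵇ x y e) ⇔ PairIs x y e
T-pairIsᵇ x y (a , b) = mk⇔
  (Sum.map (to (T-eqᵇ∧eqᵇ x a y b)) (to (T-eqᵇ∧eqᵇ x b y a)) ∘ to (T-∨ {eqᵇ x a ∧ eqᵇ y b}))
  (from (T-∨ {eqᵇ x a ∧ eqᵇ y b}) ∘ Sum.map (from (T-eqᵇ∧eqᵇ x a y b)) (from (T-eqᵇ∧eqᵇ x b y a)))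

⟦pairIsᵇ⟧ : (x y a b : Point u g) → a ≢ b →
  ⟦ pairIsᵇ x y (a , b) ⟧ ≡ ⟦ eqᵇ x a ∧ eqᵇ y b ⟧ + ⟦ eqᵇ x b ∧ eqᵇ y a ⟧
⟦pairIsᵇ⟧ x y a b a≢b = ⟦∨⟧-disjoint (eqᵇ x a ∧ eqᵇ y b) _ λ (xa , xb) →
  a≢b (trans (sym (proj₁ (to (T-eqᵇ∧eqᵇ x a y b) xa))) (proj₁ (to (T-eqᵇ∧eqᵇ x b y a) xb)))

inTripleᵇ-sound : (x a b c : Point u g) → T (inTripleᵇ x (a , b , c)) → x ≡ a ⊎ x ≡ b ⊎ x ≡ c
inTripleᵇ-sound x a b c =
  Sum.map (to (T-eqᵇ x a)) (Sum.map (to (T-eqᵇ x b)) (to (T-eqᵇ x c)) ∘ to (T-∨ {eqᵇ x b}))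
  ∘ to (T-∨ {eqᵇ x a})

TriangleIn-edge : ∀ {E : List (Edge u g)} {a b c x y} → TriangleIn E (a , b , c) → x ≢ y →
  x ≡ a ⊎ x ≡ b ⊎ x ≡ c → y ≡ a ⊎ y ≡ b ⊎ y ≡ c → ∃ λ e → e ∈ E × PairIs x y e
TriangleIn-edge _ x≢y (inj₁ refl)        (inj₁ refl)        = contradiction refl x≢y
TriangleIn-edge _ x≢y (inj₂ (inj₁ refl)) (inj₂ (inj₁ refl)) = contradiction refl x≢y
TriangleIn-edge _ x≢y (inj₂ (inj₂ refl)) (inj₂ (inj₂ refl)) = contradiction refl x≢y
TriangleIn-edge (ab , ac , bc) _ (inj₁ refl)        (inj₂ (inj₁ refl)) = ab
TriangleIn-edge (ab , ac , bc) _ (inj₁ refl)        (inj₂ (inj₂ refl)) = ac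
TriangleIn-edge (ab , ac , bc) _ (inj₂ (inj₁ refl)) (inj₂ (inj₂ refl)) = bc
TriangleIn-edge ((e , e∈ , p) , _ , _) _ (inj₂ (inj₁ refl)) (inj₁ refl) = e , e∈ , PairIs-swap p
TriangleIn-edge (_ , (e , e∈ , p) , _) _ (inj₂ (inj₂ refl)) (inj₁ refl) = e , e∈ , PairIs-swap p
TriangleIn-edge (_ , _ , (e , e∈ , p)) _ (inj₂ (inj₂ refl)) (inj₂ (inj₁ refl)) = e , e∈ , PairIs-swap p

freq-outside : ∀ {E : List (Edge u g)} {B x y} → All (TriangleIn E) B → x ≢ y →
  (∀ e → e ∈ E → ¬ PairIs x y e) → freq B x y ≡ 0
freq-outside {B = B} {x} {y} B⊆E x≢y outside = countᵇ≡0 _ B λ where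
  (a , b , c) t∈ xy∈t →
    let x∈t , y∈t = to (T-∧ {inTripleᵇ x (a , b , c)}) xy∈t
        e , e∈ , p = TriangleIn-edge (All.lookup B⊆E t∈) x≢y
                       (inTripleᵇ-sound x a b c x∈t) (inTripleᵇ-sound y a b c y∈t)
    in outside e e∈ p

-- Double counting the edges of K_u · \bar{K_g}

-- Opaque, so that the summand of ∑ₚ f can be recovered by unification.
opaque
  ∑ₚ : (Point u g → ℕ) → ℕ
  ∑ₚ {u} {g} f = ∑[ i < u ] ∑[ j < g ] f (i , j)

  ∑ₚ≡∑∑ : (f : Point u g → ℕ) → ∑ₚ f ≡ ∑[ i < u ] ∑[ j < g ] f (i , j)
  ∑ₚ≡∑∑ f = refl

  ∑ₚ-cong : {f h : Point u g → ℕ} → (∀ x → f x ≡ h x) → ∑ₚ f ≡ ∑ₚ h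
  ∑ₚ-cong f≡h = sum-cong-≗ (λ i → sum-cong-≗ (λ j → f≡h (i , j)))

  ∑ₚ-distrib-+ : (f h : Point u g → ℕ) → ∑ₚ (λ x → f x + h x) ≡ ∑ₚ f + ∑ₚ h
  ∑ₚ-distrib-+ {u} {g} f h =
    trans (sum-cong-≗ (λ i → ∑-distrib-+ (λ j → f (i , j)) (λ j → h (i , j))))
          (∑-distrib-+ {u} (λ i → ∑[ j < g ] f (i , j)) (λ i → ∑[ j < g ] h (i , j)))

  ∑ₚ-zero : {h : Point u g → ℕ} → (∀ x → h x ≡ 0) → ∑ₚ h ≡ 0
  ∑ₚ-zero {u} {g} h≡0 = ∑-zero {u} (λ i → ∑-zero {g} (λ j → h≡0 (i , j)))

  ∑ₚ-const : ∀ c → ∑ₚ {u} {g} (λ _ → c) ≡ u * (g * c)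
  ∑ₚ-const {u} {g} c = trans (sum-cong-≗ {u} (λ _ → ∑-const g c)) (∑-const u (g * c))

  ∑ₚ-single : (h : Point u g → ℕ) (a : Point u g) → (∀ x → x ≢ a → h x ≡ 0) → ∑ₚ h ≡ h a
  ∑ₚ-single {u} {g} h (i , j) h≡0 =
    trans (∑-single (λ i′ → ∑[ j′ < g ] h (i′ , j′)) i
                    (λ i′ i′≢i → ∑-zero {g} (λ j′ → h≡0 (i′ , j′) (i′≢i ∘ cong proj₁))))
          (∑-single (λ j′ → h (i , j′)) j (λ j′ j′≢j → h≡0 (i , j′) (j′≢j ∘ cong proj₂)))

∑ₚ-indicator : (a b : Point u g) → ∑ₚ (λ x → ∑ₚ (λ y → ⟦ eqᵇ x a ∧ eqᵇ y b ⟧)) ≡ 1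
∑ₚ-indicator a b =
  trans (∑ₚ-single _ a λ x x≢a → ∑ₚ-zero λ y →
           ⟦⟧≡0 (eqᵇ x a ∧ eqᵇ y b) (x≢a ∘ proj₁ ∘ to (T-eqᵇ∧eqᵇ x a y b)))
  (trans (∑ₚ-single _ b λ y y≢b →
           ⟦⟧≡0 (eqᵇ a a ∧ eqᵇ y b) (y≢b ∘ proj₂ ∘ to (T-eqᵇ∧eqᵇ a a y b)))
         (⟦⟧≡1 (eqᵇ a a ∧ eqᵇ b b) (from (T-eqᵇ∧eqᵇ a a b b) (refl , refl))))

-- Each edge {a, b} is seen from both orderings (a, b) and (b, a).
∑ₚ-pairIsᵇ : {a b : Point u g} → a ≢ b → ∑ₚ (λ x → ∑ₚ (λ y → ⟦ pairIsᵇ x y (a , b) ⟧)) ≡ 2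
∑ₚ-pairIsᵇ {a = a} {b} a≢b = begin
  ∑ₚ (λ x → ∑ₚ (λ y → ⟦ pairIsᵇ x y (a , b) ⟧))
    ≡⟨ ∑ₚ-cong (λ x → trans (∑ₚ-cong (λ y → ⟦pairIsᵇ⟧ x y a b a≢b)) (∑ₚ-distrib-+ _ _)) ⟩
  ∑ₚ (λ x → ∑ₚ (λ y → ⟦ eqᵇ x a ∧ eqᵇ y b ⟧) + ∑ₚ (λ y → ⟦ eqᵇ x b ∧ eqᵇ y a ⟧))
    ≡⟨ ∑ₚ-distrib-+ _ _ ⟩
  ∑ₚ (λ x → ∑ₚ (λ y → ⟦ eqᵇ x a ∧ eqᵇ y b ⟧)) + ∑ₚ (λ x → ∑ₚ (λ y → ⟦ eqᵇ x b ∧ eqᵇ y a ⟧))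
    ≡⟨ cong₂ _+_ (∑ₚ-indicator a b) (∑ₚ-indicator b a) ⟩
  2 ∎
  where open ≡-Reasoning

∑ₚ-countᵇ-pairIsᵇ : (L : List (Edge u g)) → All (λ e → proj₁ e ≢ proj₂ e) L →
  ∑ₚ (λ x → ∑ₚ (λ y → countᵇ (pairIsᵇ x y) L)) ≡ 2 * length L
∑ₚ-countᵇ-pairIsᵇ []      []          = ∑ₚ-zero (λ _ → ∑ₚ-zero (λ _ → refl))
∑ₚ-countᵇ-pairIsᵇ {u} {g} (e ∷ L) (a≢b ∷ L≢) = begin
  ∑ₚ (λ x → ∑ₚ (λ y → countᵇ (pairIsᵇ x y) (e ∷ L)))
    ≡⟨ ∑ₚ-cong (λ x → trans (∑ₚ-cong (λ y → countᵇ-∷ (pairIsᵇ x y) e L))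
                            (∑ₚ-distrib-+ {u} {g} _ _)) ⟩
  ∑ₚ (λ x → ∑ₚ (λ y → ⟦ pairIsᵇ x y e ⟧) + ∑ₚ (λ y → countᵇ (pairIsᵇ x y) L))
    ≡⟨ ∑ₚ-distrib-+ {u} {g} _ _ ⟩
  ∑ₚ (λ x → ∑ₚ (λ y → ⟦ pairIsᵇ x y e ⟧)) + ∑ₚ (λ x → ∑ₚ (λ y → countᵇ (pairIsᵇ x y) L))
    ≡⟨ cong₂ _+_ (∑ₚ-pairIsᵇ a≢b) (∑ₚ-countᵇ-pairIsᵇ L L≢) ⟩
  2 + 2 * length L
    ≡⟨ *-suc 2 (length L) ⟨
  2 * length (e ∷ L) ∎
  where open ≡-Reasoning

∑ₚ-countᵇ-row : (L : List (Edge u g)) → All (λ e → Cross (proj₁ e) (proj₂ e)) L →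
  (∀ x y → Cross x y → countᵇ (pairIsᵇ x y) L ≡ 1) →
  ∀ x → ∑ₚ (λ y → countᵇ (pairIsᵇ x y) L) ≡ (u ∸ 1) * g
∑ₚ-countᵇ-row {u = suc m} {g} L cross once x@(i , _) =
  trans (∑ₚ≡∑∑ _) (trans (∑-const-off _ i other-group) (cong (_+ m * g) own-group))
  where
  own-group : ∑[ l < g ] countᵇ (pairIsᵇ x (i , l)) L ≡ 0
  own-group = ∑-zero λ l → countᵇ≡0 _ L λ e e∈ xy∈e →
    PairIs-cross (to (T-pairIsᵇ x (i , l) e) xy∈e) (All.lookup cross e∈) refl
  other-group : ∀ j → j ≢ i → ∑[ l < g ] countᵇ (pairIsᵇ x (j , l)) L ≡ g
  other-group j j≢i =
    trans (sum-cong-≗ (λ l → once x (j , l) (j≢i ∘ sym))) (trans (∑-const g 1) (*-identityʳ g))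

length≡g*g*uC2 : (L : List (Edge u g)) → All (λ e → Cross (proj₁ e) (proj₂ e)) L →
  (∀ x y → Cross x y → countᵇ (pairIsᵇ x y) L ≡ 1) → length L ≡ g * g * (u C 2)
length≡g*g*uC2 {u} {g} L cross once = *-cancelˡ-≡ _ _ 2 (begin
  2 * length L
    ≡⟨ ∑ₚ-countᵇ-pairIsᵇ L (All.map cross⇒≢ cross) ⟨
  ∑ₚ (λ x → ∑ₚ (λ y → countᵇ (pairIsᵇ x y) L))
    ≡⟨ trans (∑ₚ-cong (∑ₚ-countᵇ-row L cross once)) (∑ₚ-const {u} {g} _) ⟩
  u * (g * ((u ∸ 1) * g))
    ≡⟨ solve 3 (λ u g d → u :* (g :* (d :* g)) := g :* g :* (u :* d)) refl u g (u ∸ 1) ⟩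
  g * g * (u * (u ∸ 1))
    ≡⟨ cong (g * g *_) (2*nC2≡n*[n∸1] u) ⟨
  g * g * (2 * (u C 2))
    ≡⟨ solve 2 (λ s c → s :* (con 2 :* c) := con 2 :* (s :* c)) refl (g * g) (u C 2) ⟩
  2 * (g * g * (u C 2)) ∎)
  where open ≡-Reasoning

-- Gluing the starter multisets

module Starter {E : List (Edge u g)} {lo hi : ℕ} (s : HasStarterTriangles E lo hi) where

  triangles : List (Triple u g)
  triangles = proj₁ s

  valid : All IsTriangle triangles
  valid = proj₁ (proj₂ s)

  inside : All (TriangleIn E) triangles
  inside = proj₁ (proj₂ (proj₂ s))

  freq-injective : ∀ e e′ → e ∈ E → e′ ∈ E →
    freq triangles (proj₁ e) (proj₂ e) ≡ freq triangles (proj₁ e′) (proj₂ e′) →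
    PairIs (proj₁ e) (proj₂ e) e′
  freq-injective = proj₁ (proj₂ (proj₂ (proj₂ s)))

  freq-range : ∀ e → e ∈ E →
    lo ≤ freq triangles (proj₁ e) (proj₂ e) × freq triangles (proj₁ e) (proj₂ e) < hi
  freq-range = proj₁ (proj₂ (proj₂ (proj₂ (proj₂ s))))

  freq-onto : ∀ t → lo ≤ t → t < hi → ∃ λ e → e ∈ E × freq triangles (proj₁ e) (proj₂ e) ≡ t
  freq-onto = proj₂ (proj₂ (proj₂ (proj₂ (proj₂ s))))

module Decomposition {G : Fin k → List (Edge u g)} (decomposition : IsEdgeDecomposition G) where

  covered-once : ∀ x y → Cross x y → ∑[ i < k ] countᵇ (pairIsᵇ x y) (G i) ≡ 1
  covered-once x y c =
    trans (sym (sum-map-allFin (λ i → countᵇ (pairIsᵇ x y) (G i)))) (proj₂ decomposition x y c)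

  edge-owner : ∀ x y → Cross x y → ∃ λ i → ∃ λ e → e ∈ G i × PairIs x y e
  edge-owner x y c =
    let i , count>0 = ∑-positive _ (subst (0 <_) (sym (covered-once x y c)) (s≤s z≤n))
        e , e∈ , xy∈e = countᵇ>0⇒∈ (pairIsᵇ x y) (G i) count>0
    in i , e , e∈ , to (T-pairIsᵇ x y e) xy∈e

  edge-owner-unique : ∀ {x y i j e e′} → Cross x y →
    e ∈ G i → PairIs x y e → e′ ∈ G j → PairIs x y e′ → i ≡ j
  edge-owner-unique {x} {y} {e = e} {e′} c e∈ p e′∈ p′ = ∑≡1-positive-unique _ (covered-once x y c)
    (∈⇒countᵇ>0 (pairIsᵇ x y) _ e∈ (from (T-pairIsᵇ x y e) p))
    (∈⇒countᵇ>0 (pairIsᵇ x y) _ e′∈ (from (T-pairIsᵇ x y e′) p′))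

  ∑-lengths : ∑[ i < k ] length (G i) ≡ g * g * (u C 2)
  ∑-lengths = trans (sym (length-concat-tabulate G))
    (length≡g*g*uC2 _ (concat⁺ (tabulate⁺ (proj₁ decomposition)))
      λ x y c → trans (countᵇ-concat (pairIsᵇ x y) G) (covered-once x y c))

  module _ {Δ : Fin k → List (Triple u g)} (Δ-inside : ∀ i → All (TriangleIn (G i)) (Δ i)) where

    freq-concat-same-group : ∀ x y → x ≢ y → SameGroup x y → freq (concat (tabulate Δ)) x y ≡ 0
    freq-concat-same-group x y x≢y same = trans (countᵇ-concat _ Δ) (∑-zero λ j →
      freq-outside (Δ-inside j) x≢y λ e e∈ p →
        PairIs-cross p (All.lookup (proj₁ decomposition j) e∈) same)

    freq-concat-pair : ∀ {x y i e} → e ∈ G i → PairIs x y e →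
      freq (concat (tabulate Δ)) x y ≡ freq (Δ i) (proj₁ e) (proj₂ e)
    freq-concat-pair {x} {y} {i} {e} e∈ p = begin
      freq (concat (tabulate Δ)) x y   ≡⟨ countᵇ-concat _ Δ ⟩
      ∑[ j < k ] freq (Δ j) x y       ≡⟨ ∑-single (λ j → freq (Δ j) x y) i absent-elsewhere ⟩
      freq (Δ i) x y                  ≡⟨ freq-PairIs (Δ i) e p ⟩
      freq (Δ i) (proj₁ e) (proj₂ e)  ∎
      where
      open ≡-Reasoning
      c : Cross x y
      c = PairIs-cross p (All.lookup (proj₁ decomposition i) e∈)
      absent-elsewhere : ∀ j → j ≢ i → freq (Δ j) x y ≡ 0
      absent-elsewhere j j≢i = freq-outside (Δ-inside j) (cross⇒≢ c) λ e′ e′∈ p′ →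
        j≢i (edge-owner-unique c e′∈ p′ e∈ p)

module _ {μ} {G : Fin k → List (Edge u g)} (decomposition : IsEdgeDecomposition G)
  (starters : ∀ i → HasStarterTriangles (G i)
                      (μ + before (λ j → length (G j)) i)
                      (μ + before (λ j → length (G j)) i + length (G i))) where

  open Decomposition decomposition

  private
    len : Fin k → ℕ
    len i = length (G i)

    Δ : Fin k → List (Triple u g)
    Δ i = Starter.triangles (starters i)

    B : List (Triple u g)
    B = concat (tabulate Δ)

    freq-B-pair : ∀ {x y i e} → e ∈ G i → PairIs x y e → freq B x y ≡ freq (Δ i) (proj₁ e) (proj₂ e)
    freq-B-pair = freq-concat-pair (λ i → Starter.inside (starters i))

    freq-B-block : ∀ {x y i e} → e ∈ G i → PairIs x y e → InBlock μ len i (freq B x y)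
    freq-B-block {i = i} {e} e∈ p =
      let lo , hi = Starter.freq-range (starters i) e e∈
      in subst (InBlock μ len i) (sym (freq-B-pair e∈ p)) (inBlock lo hi)

    freq-B-bounds : ∀ x y → Cross x y → μ ≤ freq B x y × freq B x y < μ + g * g * (u C 2)
    freq-B-bounds x y c =
      let _ , _ , e∈ , p = edge-owner x y c
          μ≤ , <μ+∑ = inBlock-bounds (freq-B-block e∈ p)
      in μ≤ , subst (λ n → freq B x y < μ + n) ∑-lengths <μ+∑

    freq-B-injective : ∀ x y x′ y′ → Cross x y → Cross x′ y′ →
      freq B x y ≡ freq B x′ y′ → PairIs x y (x′ , y′)
    freq-B-injective x y x′ y′ c c′ same with edge-owner x y c | edge-owner x′ y′ c′
    ... | i , e , e∈ , p | i′ , e′ , e′∈ , p′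
        with inBlock-unique (freq-B-block e∈ p)
                            (subst (InBlock μ len i′) (sym same) (freq-B-block e′∈ p′))
    ... | refl = PairIs-trans (PairIs-trans p e≐e′) (PairIs-sym p′)
      where
      e≐e′ : PairIs (proj₁ e) (proj₂ e) e′
      e≐e′ = Starter.freq-injective (starters i) e e′ e∈ e′∈
               (trans (sym (freq-B-pair e∈ p)) (trans same (freq-B-pair e′∈ p′)))

    freq-B-onto : ∀ t → μ ≤ t → t < μ + g * g * (u C 2) →
      ∃ λ x → ∃ λ y → Cross x y × freq B x y ≡ t
    freq-B-onto t μ≤t t< =
      let i , inBlock lo hi = inBlock-cover len μ≤t (subst (λ n → t < μ + n) (sym ∑-lengths) t<)
          e , e∈ , freq≡t = Starter.freq-onto (starters i) t lo hi
      in proj₁ e , proj₂ e , All.lookup (proj₁ decomposition i) e∈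
       , trans (freq-B-pair e∈ (inj₁ (refl , refl))) freq≡t

  starter-union-SBGDD : SBGDD μ g u
  starter-union-SBGDD = B
    , concat⁺ (tabulate⁺ (λ i → Starter.valid (starters i)))
    , freq-concat-same-group (λ i → Starter.inside (starters i))
    , freq-B-bounds
    , freq-B-injective
    , freq-B-onto

mainTheorem4 : (μ g u : ℕ) → 1 ≤ g → 3 ≤ u →
    (k : ℕ) (G : Fin k → List (Edge u g)) →
    IsEdgeDecomposition G →
    (∀ (i : Fin k) →
       HasStarterTriangles (G i)
         (μ + before (λ j → length (G j)) i)
         (μ + before (λ j → length (G j)) i + length (G i))) →
    SBGDD μ g u
mainTheorem4 μ g u _ _ k G decomposition starters = starter-union-SBGDD decomposition starters
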